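{- Let $M$ be a simple matroid on $n$ elements whose dual $M^*$ is also simple. Let $d$ be the size of a smallest cocircuit of $M$ and $d^*$ the size of a smallest circuit of $M$. Write $\chi_M(S,T)=\sum_{i}\chi_i(T)S^i$ and $\mu_M(S,T)=\sum_i\mu_i(T)S^i$. Then \[ \chi_i(T)=\begin{cases}\mu_i(T) & \text{for } i<d^*-1,\\ 0 & \text{for } n-d<i<n,\\ 1 & \text{for } i=n.\end{cases} \]
   Context: A matroid is simple if it has no loops and no parallel elements. For a simple matroid $M$, let $L$ be its geometric lattice of flats with rank function $r$, Möbius function $\mu$, and $r(L)=r(M)$; for $x\in L$, $a(x)$ is the number of atoms of $L$ below $x$. The coboundary polynomial is $\chi_M(S,T)=\sum_{x\in L}\sum_{x\le y\in L}\mu(x,y)S^{a(x)}T^{r(L)-r(y)}$ and the Möbius polynomial is $\mu_M(S,T)=\sum_{x\in L}\sum_{x\le y\in L}\mu(x,y)S^{r(x)}T^{r(L)-r(y)}$; $\chi_i(T)$ and $\mu_i(T)$ denote the coefficients of $S^i$ in these polynomials (zero when no such term occurs). -}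

module Defs where

open import Data.Nat using (ℕ; zero; suc; _≤_; _<_; _+_; _∸_; _<?_)
import Data.Nat as ℕ
open import Data.Integer using (ℤ; -_) renaming (_+_ to _+ℤ_; 0ℤ to 0ℤ; 1ℤ to 1ℤ)
open import Data.Bool using (Bool; true; false)
import Data.Bool.Properties as BoolP
open import Data.Fin using (Fin)
open import Data.Fin.Properties using (all?)
open import Data.Fin.Subset using (Subset; _⊆_; _⊂_; _∪_; _∩_; ∁; ⁅_⁆; ∣_∣; ⊤; _∉_; outside; inside)
open import Data.Fin.Subset.Properties using (_⊆?_; _⊂?_; _∈?_)
open import Data.Vec using (Vec; []; _∷_)
open import Data.Vec.Properties using (≡-dec)
open import Data.List using (List; []; _∷_; map; filter; concatMap; foldr; length; _++_)
open import Data.Product using (_×_; _,_)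
open import Relation.Nullary using (¬_; ¬?; Dec; yes; no)
open import Relation.Nullary.Decidable using (_×-dec_; _→-dec_)
open import Relation.Binary.PropositionalEquality using (_≡_; _≢_)

record IsMatroid {n : ℕ} (r : Subset n → ℕ) : Set where
  field
    rank-≤-size : ∀ X → r X ≤ ∣ X ∣
    rank-mono   : ∀ X Y → X ⊆ Y → r X ≤ r Y
    rank-submod : ∀ X Y → r (X ∪ Y) + r (X ∩ Y) ≤ r X + r Y

dualRank : {n : ℕ} → (Subset n → ℕ) → Subset n → ℕ
dualRank r X = (∣ X ∣ + r (∁ X)) ∸ r ⊤

module _ {n : ℕ} (r : Subset n → ℕ) where

  Dependent : Subset n → Set
  Dependent X = r X < ∣ X ∣

  Circuit : Subset n → Set
  Circuit C = Dependent C × (∀ D → D ⊂ C → ¬ Dependent D)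

  Loop : Fin n → Set
  Loop e = Circuit ⁅ e ⁆

  Parallel : Fin n → Fin n → Set
  Parallel e f = e ≢ f × Circuit (⁅ e ⁆ ∪ ⁅ f ⁆)

  Simple : Set
  Simple = (∀ e → ¬ Loop e) × (∀ e f → ¬ Parallel e f)

  IsMinCircuitSize : ℕ → Set
  IsMinCircuitSize d =
    (Data.Product.Σ (Subset n) λ C → Circuit C × ∣ C ∣ ≡ d) × (∀ C → Circuit C → d ≤ ∣ C ∣)

Cocircuit : {n : ℕ} → (Subset n → ℕ) → Subset n → Set
Cocircuit r = Circuit (dualRank r)

IsMinCocircuitSize : {n : ℕ} → (Subset n → ℕ) → ℕ → Set
IsMinCocircuitSize r = IsMinCircuitSize (dualRank r)

allSubsets : (n : ℕ) → List (Subset n)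
allSubsets zero = [] ∷ []
allSubsets (suc n) = map (outside ∷_) (allSubsets n) ++ map (inside ∷_) (allSubsets n)

_≟S_ : {n : ℕ} → (X Y : Subset n) → Dec (X ≡ Y)
_≟S_ = ≡-dec BoolP._≟_

sumℤ : List ℤ → ℤ
sumℤ = foldr _+ℤ_ 0ℤ

module Lattice {n : ℕ} (r : Subset n → ℕ) where

  Flat : Subset n → Set
  Flat X = ∀ e → e ∉ X → r X < r (X ∪ ⁅ e ⁆)

  flat? : ∀ X → Dec (Flat X)
  flat? X = all? (λ e → ¬? (e ∈? X) →-dec (r X <? r (X ∪ ⁅ e ⁆)))

  flats : List (Subset n)
  flats = filter flat? (allSubsets n)

  rL : ℕ
  rL = r ⊤

  -- Defined with fuel; fuel suc n suffices since
  -- chains of strictly increasing subsets of Fin n have length ≤ n.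
  mobF : ℕ → Subset n → Subset n → ℤ
  mobF zero x y = 0ℤ
  mobF (suc k) x y with x ≟S y
  ... | yes _ = 1ℤ
  ... | no _ with x ⊆? y
  ...   | yes _ = - sumℤ (map (mobF k x) (filter (λ z → (x ⊆? z) ×-dec (z ⊂? y)) flats))
  ...   | no _ = 0ℤ

  μ : Subset n → Subset n → ℤ
  μ = mobF (suc n)

  atoms : List (Subset n)
  atoms = filter (λ z → r z Data.Nat.≟ 1) flats

  a : Subset n → ℕ
  a x = length (filter (λ z → z ⊆? x) atoms)

  pairs : List (Subset n × Subset n)
  pairs = concatMap (λ x → map (x ,_) (filter (x ⊆?_) flats)) flats

  -- coefficient of S^i T^j in Σ_{x≤y} μ(x,y) S^{g(x)} T^{r(L)-r(y)}
  coeffWith : (Subset n → ℕ) → ℕ → ℕ → ℤ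
  coeffWith g i j =
    sumℤ (map (λ { (x , y) → μ x y })
      (filter (λ { (x , y) → (g x Data.Nat.≟ i) ×-dec ((rL ∸ r y) Data.Nat.≟ j) }) pairs))

  -- χ_i(T): coefficient of S^i in the coboundary polynomial, as the
  -- function j ↦ (coefficient of T^j)
  χ : ℕ → ℕ → ℤ
  χ = coeffWith a

  μPoly : ℕ → ℕ → ℤ
  μPoly = coeffWith r

onePoly : ℕ → ℤ
onePoly zero = 1ℤ
onePoly (suc _) = 0ℤ

module Submission where

-- Both polynomials are sums over
-- pairs of flats x ≤ y of μ(x,y) T^(r(E) − r(y)); they differ only in the
-- exponent of S, which is a(x) resp. r(x).  The whole proof rests on
--
--   (A) in a simple matroid the atoms of the lattice of flats are exactly
--       the one-element sets, so a(x) = ∣x∣ for every x;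
--
-- together with three observations on sets x ⊆ E:
--   (1) if i + 1 < d* (the girth), then ∣x∣ = i ⇔ r(x) = i, since neither
--       kind of set can contain a circuit; hence χᵢ = μᵢ;
--   (2) a flat x with ∣x∣ < n has r(x) < r(E), so its complement is
--       dependent in M* and has at least d elements; hence no flat has
--       n − d < ∣x∣ < n and χᵢ = 0 there;
--   (3) the only flat with ∣x∣ = n is E, and the only pair above it is
--       (E, E) with μ(E,E) = 1; hence χₙ = 1.
-- The file first collects list and finite-set facts, the enumeration of
-- subsets, general facts on circuits, then (A), then the three coefficient
-- principles (agreement, vanishing, concentration at the top), and finally
-- derives the theorem.

open import Defs
open import Data.Nat using (ℕ; _<_; _+_)
open import Data.Integer using (ℤ; 0ℤ; 1ℤ)
open import Data.Fin.Subset using (Subset)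
open import Data.Product using (_×_)
open import Relation.Binary.PropositionalEquality using (_≡_)

open import Data.Nat using (suc; _≤_; _∸_; z≤n; s≤s; _<?_; >-nonZero)
import Data.Nat as ℕ
import Data.Nat.Properties as ℕ
import Data.Integer.Properties as ℤ
open import Data.Bool using (not)
open import Data.Bool.Properties using (not-involutive)
open import Data.Fin as Fin using (Fin)
open import Data.Fin.Subset
  using (_⊆_; _⊂_; _∪_; ∁; ⁅_⁆; ∣_∣; ⊤; ⊥; _∈_; _∉_; _-_; outside; inside; Nonempty)
open import Data.Fin.Subset.Properties
  using ( _⊆?_; _⊂?_; anySubset?; nonempty?; Empty-unique; ∣⊥∣≡0; ∣⁅x⁆∣≡1; ∣∁p∣≡n∸∣p∣
        ; ∣p∣≡n⇒p≡⊤; ∣⊤∣≡n; p⊆q⇒∣p∣≤∣q∣; p⊂q⇒∣p∣<∣q∣; ⊆-antisym; ⊆-trans; ⊆⊤; ∈⊤; ⊥⊆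
        ; x∈⁅x⁆; x∈⁅y⁆⇒x≡y; p⊆p∪q; x∈p∪q⁺; x∈p∪q⁻; x∈∁p⇒x∉p; x∈p⇒p-x⊂p; p─⊥≡p
        ; drop-∷-⊆; out⊆; in⊆in )
open import Data.Vec as Vec using (_∷_; here)
open import Data.Vec.Properties using (∷-injectiveˡ; ∷-injectiveʳ; map-∘; map-cong; map-id)
open import Data.List using (List; []; _∷_; map; filter; concatMap; length; _++_)
open import Data.List.Properties using (filter-≐; filter-accept; filter-reject; filter-none; filter-all; filter-++; length-++; length-map; ++-identityʳ)
open import Data.List.Relation.Unary.All as All using (All)
open import Data.List.Relation.Unary.All.Properties using (all-filter; map⁺; concat⁺)
open import Data.Product using (Σ; _,_; proj₁; proj₂)
open import Data.Sum using ([_,_]′; inj₂)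
open import Function using (_∘_)
open import Relation.Unary using (Decidable)
open import Relation.Nullary using (¬_; Dec; yes; no; contradiction)
open import Relation.Nullary.Decidable using (_×-dec_)
open import Relation.Binary.PropositionalEquality using (refl; sym; trans; cong; cong₂; subst; subst₂; _≢_; module ≡-Reasoning)

module _ {A : Set} where

  filter-ext : {P Q : A → Set} (P? : Decidable P) (Q? : Decidable Q)
    → (∀ x → P x → Q x) → (∀ x → Q x → P x) → ∀ xs → filter P? xs ≡ filter Q? xs
  filter-ext P? Q? P⇒Q Q⇒P = filter-≐ P? Q? ((λ {x} → P⇒Q x) , (λ {x} → Q⇒P x))

  filter-filter : {P Q : A → Set} (P? : Decidable P) (Q? : Decidable Q) (xs : List A)
    → filter P? (filter Q? xs) ≡ filter (λ x → Q? x ×-dec P? x) xs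
  filter-filter P? Q? [] = refl
  filter-filter P? Q? (x ∷ xs) with Q? x | P? x
  ... | yes _ | yes p = trans (filter-accept P? p) (cong (x ∷_) (filter-filter P? Q? xs))
  ... | yes _ | no ¬p = trans (filter-reject P? ¬p) (filter-filter P? Q? xs)
  ... | no _  | _     = filter-filter P? Q? xs

module _ {A B : Set} where

  filter-map : {P : B → Set} (P? : Decidable P) (f : A → B) (xs : List A)
    → filter P? (map f xs) ≡ map f (filter (P? ∘ f) xs)
  filter-map P? f [] = refl
  filter-map P? f (x ∷ xs) with P? (f x)
  ... | yes _ = cong (f x ∷_) (filter-map P? f xs)
  ... | no _  = filter-map P? f xs

  filter-by-fst : {P : A → Set} (P? : Decidable P) (g : A → List B) (xs : List A)
    → filter (P? ∘ proj₁) (concatMap (λ x → map (x ,_) (g x)) xs)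
      ≡ concatMap (λ x → map (x ,_) (g x)) (filter P? xs)
  filter-by-fst P? g [] = refl
  filter-by-fst P? g (x ∷ xs) with P? x
  ... | yes p = trans (filter-++ (P? ∘ proj₁) (map (x ,_) (g x)) _)
                  (cong₂ _++_ (filter-all (P? ∘ proj₁) (map⁺ (All.universal (λ _ → p) (g x))))
                              (filter-by-fst P? g xs))
  ... | no ¬p = trans (filter-++ (P? ∘ proj₁) (map (x ,_) (g x)) _)
                  (cong₂ _++_ (filter-none (P? ∘ proj₁) (map⁺ (All.universal (λ _ → ¬p) (g x))))
                              (filter-by-fst P? g xs))

∣p∣≡0⇒p≡⊥ : ∀ {n} (p : Subset n) → ∣ p ∣ ≡ 0 → p ≡ ⊥
∣p∣≡0⇒p≡⊥ Vec.[] _ = refl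
∣p∣≡0⇒p≡⊥ (outside ∷ p) h = cong (outside ∷_) (∣p∣≡0⇒p≡⊥ p h)
∣p∣≡0⇒p≡⊥ (inside ∷ p) ()

∣p∣≡1⇒singleton : ∀ {n} (p : Subset n) → ∣ p ∣ ≡ 1 → Σ (Fin n) λ e → p ≡ ⁅ e ⁆
∣p∣≡1⇒singleton (outside ∷ p) h with ∣p∣≡1⇒singleton p h
... | e , refl = Fin.suc e , refl
∣p∣≡1⇒singleton (inside ∷ p) h = Fin.zero , cong (inside ∷_) (∣p∣≡0⇒p≡⊥ p (ℕ.suc-injective h))

0<∣p∣⇒nonempty : ∀ {n} (p : Subset n) → 0 < ∣ p ∣ → Nonempty p
0<∣p∣⇒nonempty {n} p pos with nonempty? p
... | yes ne = ne
... | no empty = contradiction (trans (cong ∣_∣ (Empty-unique empty)) (∣⊥∣≡0 n)) (ℕ.>⇒≢ pos)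

-- Complementation is an involution (dualRank evaluates r at ∁ (∁ x)).
∁-involutive : ∀ {n} (p : Subset n) → ∁ (∁ p) ≡ p
∁-involutive p = trans (sym (map-∘ not not p)) (trans (map-cong not-involutive p) (map-id p))

∣p∣≤1+∣p-x∣ : ∀ {n} (p : Subset n) x → ∣ p ∣ ≤ suc ∣ p - x ∣
∣p∣≤1+∣p-x∣ (outside ∷ p) Fin.zero = subst (λ q → ∣ p ∣ ≤ suc ∣ q ∣) (sym (p─⊥≡p p)) (ℕ.n≤1+n _)
∣p∣≤1+∣p-x∣ (inside ∷ p) Fin.zero = subst (λ q → suc ∣ p ∣ ≤ suc ∣ q ∣) (sym (p─⊥≡p p)) ℕ.≤-refl
∣p∣≤1+∣p-x∣ (outside ∷ p) (Fin.suc x) = ∣p∣≤1+∣p-x∣ p x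
∣p∣≤1+∣p-x∣ (inside ∷ p) (Fin.suc x) = s≤s (∣p∣≤1+∣p-x∣ p x)

∣p∪q∣≤∣p∣+∣q∣ : ∀ {n} (p q : Subset n) → ∣ p ∪ q ∣ ≤ ∣ p ∣ + ∣ q ∣
∣p∪q∣≤∣p∣+∣q∣ Vec.[] Vec.[] = z≤n
∣p∪q∣≤∣p∣+∣q∣ (outside ∷ p) (outside ∷ q) = ∣p∪q∣≤∣p∣+∣q∣ p q
∣p∪q∣≤∣p∣+∣q∣ (outside ∷ p) (inside ∷ q) =
  subst (suc ∣ p ∪ q ∣ ≤_) (sym (ℕ.+-suc ∣ p ∣ ∣ q ∣)) (s≤s (∣p∪q∣≤∣p∣+∣q∣ p q))
∣p∪q∣≤∣p∣+∣q∣ (inside ∷ p) (outside ∷ q) = s≤s (∣p∪q∣≤∣p∣+∣q∣ p q)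
∣p∪q∣≤∣p∣+∣q∣ (inside ∷ p) (inside ∷ q) =
  s≤s (ℕ.≤-trans (∣p∪q∣≤∣p∣+∣q∣ p q) (ℕ.+-monoʳ-≤ ∣ p ∣ (ℕ.n≤1+n ∣ q ∣)))

∣pair∣≡2 : ∀ {n} (e f : Fin n) → e ≢ f → ∣ ⁅ e ⁆ ∪ ⁅ f ⁆ ∣ ≡ 2
∣pair∣≡2 e f e≢f = ℕ.≤-antisym at-most at-least
  where
  at-most : ∣ ⁅ e ⁆ ∪ ⁅ f ⁆ ∣ ≤ 2
  at-most = subst (∣ ⁅ e ⁆ ∪ ⁅ f ⁆ ∣ ≤_) (cong₂ _+_ (∣⁅x⁆∣≡1 e) (∣⁅x⁆∣≡1 f)) (∣p∪q∣≤∣p∣+∣q∣ ⁅ e ⁆ ⁅ f ⁆)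
  ⁅e⁆⊂pair : ⁅ e ⁆ ⊂ ⁅ e ⁆ ∪ ⁅ f ⁆
  ⁅e⁆⊂pair = p⊆p∪q ⁅ f ⁆ , f , x∈p∪q⁺ (inj₂ (x∈⁅x⁆ f)) , λ f∈⁅e⁆ → e≢f (sym (x∈⁅y⁆⇒x≡y e f∈⁅e⁆))
  at-least : 2 ≤ ∣ ⁅ e ⁆ ∪ ⁅ f ⁆ ∣
  at-least = subst (_< ∣ ⁅ e ⁆ ∪ ⁅ f ⁆ ∣) (∣⁅x⁆∣≡1 e) (p⊂q⇒∣p∣<∣q∣ ⁅e⁆⊂pair)

⁅⁆⊆ : ∀ {n} {z : Subset n} {e} → e ∈ z → ⁅ e ⁆ ⊆ z
⁅⁆⊆ {z = z} {e} e∈z f∈⁅e⁆ = subst (_∈ z) (sym (x∈⁅y⁆⇒x≡y e f∈⁅e⁆)) e∈z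

pair⊆ : ∀ {n} {z : Subset n} {e f} → e ∈ z → f ∈ z → ⁅ e ⁆ ∪ ⁅ f ⁆ ⊆ z
pair⊆ {e = e} {f} e∈z f∈z g∈pair = [ ⁅⁆⊆ e∈z , ⁅⁆⊆ f∈z ]′ (x∈p∪q⁻ ⁅ e ⁆ ⁅ f ⁆ g∈pair)

count-split : ∀ {n} {P : Subset (suc n) → Set} (P? : Decidable P)
  → length (filter P? (allSubsets (suc n)))
    ≡ length (filter (P? ∘ (outside ∷_)) (allSubsets n)) + length (filter (P? ∘ (inside ∷_)) (allSubsets n))
count-split {n} P? = begin
  length (filter P? (map (outside ∷_) S ++ map (inside ∷_) S))
    ≡⟨ cong length (filter-++ P? (map (outside ∷_) S) _) ⟩
  length (filter P? (map (outside ∷_) S) ++ filter P? (map (inside ∷_) S))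
    ≡⟨ length-++ (filter P? (map (outside ∷_) S)) ⟩
  length (filter P? (map (outside ∷_) S)) + length (filter P? (map (inside ∷_) S))
    ≡⟨ cong₂ _+_ (counted outside) (counted inside) ⟩
  length (filter (P? ∘ (outside ∷_)) S) + length (filter (P? ∘ (inside ∷_)) S) ∎
  where
  open ≡-Reasoning
  S = allSubsets n
  counted : ∀ b → length (filter P? (map (b ∷_) S)) ≡ length (filter (P? ∘ (b ∷_)) S)
  counted b = trans (cong length (filter-map P? (b ∷_) S)) (length-map (Vec._∷_ b) (filter (P? ∘ (b ∷_)) S))

allSubsets-once : ∀ {n} (X : Subset n) → filter (_≟S X) (allSubsets n) ≡ X ∷ []
allSubsets-once Vec.[] = filter-accept (_≟S Vec.[]) {Vec.[]} {[]} refl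
allSubsets-once {suc n} (b ∷ X) =
  trans (filter-++ (_≟S (b ∷ X)) (map (outside ∷_) S) _)
    (trans (cong₂ _++_ (filter-map (_≟S (b ∷ X)) (outside ∷_) S) (filter-map (_≟S (b ∷ X)) (inside ∷_) S))
      (heads b))
  where
  S = allSubsets n
  same-head : ∀ c → filter (λ z → (c ∷ z) ≟S (c ∷ X)) S ≡ X ∷ []
  same-head c = trans (filter-ext _ (_≟S X) (λ z → ∷-injectiveʳ) (λ z → cong (c ∷_)) S) (allSubsets-once X)
  other-head : ∀ c d → c ≢ d → filter (λ z → (c ∷ z) ≟S (d ∷ X)) S ≡ []
  other-head c d c≢d = filter-none _ (All.universal (λ z eq → c≢d (∷-injectiveˡ eq)) S)
  heads : ∀ b → map (outside ∷_) (filter (λ z → (outside ∷ z) ≟S (b ∷ X)) S)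
                  ++ map (inside ∷_) (filter (λ z → (inside ∷ z) ≟S (b ∷ X)) S) ≡ (b ∷ X) ∷ []
  heads outside = cong₂ (λ l l′ → map (outside ∷_) l ++ map (inside ∷_) l′)
                    (same-head outside) (other-head inside outside λ ())
  heads inside = cong₂ (λ l l′ → map (outside ∷_) l ++ map (inside ∷_) l′)
                   (other-head outside inside λ ()) (same-head inside)

pointOf? : ∀ {n} (x : Subset n) → Decidable (λ z → (∣ z ∣ ≡ 1) × (z ⊆ x))
pointOf? x z = (∣ z ∣ ℕ.≟ 1) ×-dec (z ⊆? x)

count-points : ∀ {n} (x : Subset n) → length (filter (pointOf? x) (allSubsets n)) ≡ ∣ x ∣
count-points Vec.[] = cong length (filter-reject (pointOf? Vec.[]) {Vec.[]} {[]} λ { (() , _) })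
count-points {suc n} (c ∷ x) =
  trans (count-split (pointOf? (c ∷ x))) (trans (cong₂ _+_ outside-points refl) (inside-points c))
  where
  S = allSubsets n
  outside-points : length (filter (pointOf? (c ∷ x) ∘ (outside ∷_)) S) ≡ ∣ x ∣
  outside-points = trans
    (cong length (filter-ext (pointOf? (c ∷ x) ∘ (outside ∷_)) (pointOf? x)
      (λ { z (s , z⊆) → s , drop-∷-⊆ z⊆ }) (λ { z (s , z⊆) → s , out⊆ z⊆ }) S))
    (count-points x)
  -- inside ∷ z is a point of c ∷ x exactly when c = inside and z = ⊥
  inside-points : ∀ c → ∣ x ∣ + length (filter (pointOf? (c ∷ x) ∘ (inside ∷_)) S) ≡ ∣ c ∷ x ∣
  inside-points outside = trans (cong (∣ x ∣ +_) (cong length (filter-none _ (All.universal no-point S))))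
                            (ℕ.+-identityʳ ∣ x ∣)
    where
    no-point : ∀ z → ¬ ((∣ inside ∷ z ∣ ≡ 1) × (inside ∷ z ⊆ outside ∷ x))
    no-point z (_ , z⊆) with z⊆ here
    ... | ()
  inside-points inside = trans (cong (∣ x ∣ +_) (trans
      (cong length (filter-ext (pointOf? (inside ∷ x) ∘ (inside ∷_)) (_≟S ⊥)
        (λ z (s , _) → ∣p∣≡0⇒p≡⊥ z (ℕ.suc-injective s))
        (λ { z refl → cong suc (∣⊥∣≡0 n) , in⊆in ⊥⊆ }) S))
      (cong length (allSubsets-once (⊥ {n})))))
    (ℕ.+-comm ∣ x ∣ 1)

module Circuits {n : ℕ} (r : Subset n → ℕ) where

  dependent? : ∀ X → Dec (Dependent r X)
  dependent? X = r X <? ∣ X ∣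

  -- Every dependent set contains a circuit: pass to a dependent proper
  -- subset as long as there is one (k bounds the size of X).
  circuit⊆ : ∀ k X → ∣ X ∣ ≤ k → Dependent r X → Σ (Subset n) λ C → Circuit r C × C ⊆ X
  circuit⊆ k X X≤k dep with anySubset? (λ D → (D ⊂? X) ×-dec dependent? D)
  ... | no none = X , (dep , λ D D⊂X depD → none (D , D⊂X , depD)) , λ x∈X → x∈X
  circuit⊆ 0 X X≤k dep | yes (D , D⊂X , _) = contradiction (ℕ.<-≤-trans (p⊂q⇒∣p∣<∣q∣ D⊂X) X≤k) ℕ.n≮0
  circuit⊆ (suc k) X X≤k dep | yes (D , D⊂X , depD)
    with circuit⊆ k D (ℕ.≤-pred (ℕ.<-≤-trans (p⊂q⇒∣p∣<∣q∣ D⊂X) X≤k)) depD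
  ... | C , circuit , C⊆D = C , circuit , ⊆-trans C⊆D (proj₁ D⊂X)

  girth≤size : ∀ {g} → IsMinCircuitSize r g → ∀ X → Dependent r X → g ≤ ∣ X ∣
  girth≤size (_ , smallest) X dep with circuit⊆ ∣ X ∣ X ℕ.≤-refl dep
  ... | C , circuit , C⊆X = ℕ.≤-trans (smallest C circuit) (p⊆q⇒∣p∣≤∣q∣ C⊆X)

module Matroid {n : ℕ} (r : Subset n → ℕ) (isM : IsMatroid r) where
  open IsMatroid isM
  open Circuits r

  -- If X is dependent it contains a circuit C; for e ∈ C the set C − e is
  -- independent and inside X, so ∣C∣ − 1 ≤ r(X): the girth is at most r(X) + 1.
  girth≤1+rank : ∀ {g} → IsMinCircuitSize r g → ∀ X → Dependent r X → g ≤ suc (r X)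
  girth≤1+rank (_ , smallest) X dep with circuit⊆ ∣ X ∣ X ℕ.≤-refl dep
  ... | C , circuit@(depC , minimal) , C⊆X with 0<∣p∣⇒nonempty C (ℕ.≤-<-trans z≤n depC)
  ...   | e , e∈C = ℕ.≤-trans (smallest C circuit) (ℕ.≤-trans (∣p∣≤1+∣p-x∣ C e) (s≤s C-e≤rX))
    where
    C-e⊂C : C - e ⊂ C
    C-e⊂C = x∈p⇒p-x⊂p e∈C
    C-e≤rX : ∣ C - e ∣ ≤ r X
    C-e≤rX = ℕ.≤-trans (ℕ.≮⇒≥ (minimal (C - e) C-e⊂C)) (rank-mono (C - e) X (⊆-trans (proj₁ C-e⊂C) C⊆X))

  independent⇒rank≡size : ∀ X → ¬ Dependent r X → r X ≡ ∣ X ∣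
  independent⇒rank≡size X indep = ℕ.≤-antisym (rank-≤-size X) (ℕ.≮⇒≥ indep)

  -- Below the girth g a set of size i and a set of rank i are both
  -- independent, so "∣X∣ = i" and "r(X) = i" coincide.
  module BelowGirth {g} (girth : IsMinCircuitSize r g) (i : ℕ) (i+1<g : i + 1 < g) where

    size≡i⇒rank≡i : ∀ X → ∣ X ∣ ≡ i → r X ≡ i
    size≡i⇒rank≡i X refl = independent⇒rank≡size X λ dep →
      ℕ.<⇒≱ (ℕ.≤-<-trans (ℕ.m≤m+n ∣ X ∣ 1) i+1<g) (girth≤size girth X dep)

    rank≡i⇒size≡i : ∀ X → r X ≡ i → ∣ X ∣ ≡ i
    rank≡i⇒size≡i X rX≡i = trans (sym (independent⇒rank≡size X indep)) rX≡i
      where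
      indep : ¬ Dependent r X
      indep dep = ℕ.<⇒≱ i+1<g (subst (g ≤_) (trans (cong suc rX≡i) (ℕ.+-comm 1 i)) (girth≤1+rank girth X dep))

  -- A set of rank below r(E) with nonempty complement has codependent
  -- complement: r*(∁x) = ∣∁x∣ + r(x) − r(E) < ∣∁x∣.
  ∁-codependent : ∀ x → 0 < ∣ ∁ x ∣ → r x < r ⊤ → Dependent (dualRank r) (∁ x)
  ∁-codependent x pos rx<rE =
    subst (λ y → (∣ ∁ x ∣ + r y) ∸ r ⊤ < ∣ ∁ x ∣) (sym (∁-involutive x))
      (ℕ.m<n+o⇒m∸n<o (∣ ∁ x ∣ + r x) (r ⊤) {{>-nonZero pos}}
        (subst (∣ ∁ x ∣ + r x <_) (ℕ.+-comm ∣ ∁ x ∣ (r ⊤)) (ℕ.+-monoʳ-< ∣ ∁ x ∣ rx<rE)))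

  proper-flat-size : ∀ {d} → IsMinCocircuitSize r d → ∀ x → Lattice.Flat r x → ∣ x ∣ < n → ∣ x ∣ + d ≤ n
  proper-flat-size {d} cogirth x flat x<n =
    subst (∣ x ∣ + d ≤_) (ℕ.m+[n∸m]≡n (ℕ.<⇒≤ x<n))
      (ℕ.+-monoʳ-≤ ∣ x ∣ (subst (d ≤_) (∣∁p∣≡n∸∣p∣ x) (cogirth≤size cogirth (∁ x) codep)))
    where
    open Circuits (dualRank r) using () renaming (girth≤size to cogirth≤size)
    pos : 0 < ∣ ∁ x ∣
    pos = subst (0 <_) (sym (∣∁p∣≡n∸∣p∣ x)) (ℕ.m<n⇒0<n∸m x<n)
    outside-x : Σ (Fin n) (_∉ x)
    outside-x with 0<∣p∣⇒nonempty (∁ x) pos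
    ... | e , e∈∁x = e , x∈∁p⇒x∉p e∈∁x
    rx<rE : r x < r ⊤
    rx<rE = ℕ.<-≤-trans (flat (proj₁ outside-x) (proj₂ outside-x)) (rank-mono _ ⊤ ⊆⊤)
    codep : Dependent (dualRank r) (∁ x)
    codep = ∁-codependent x pos rx<rE

module SimpleMatroid {n : ℕ} (r : Subset n → ℕ) (isM : IsMatroid r) (simple : Simple r) where
  open IsMatroid isM
  open Lattice r

  -- No loops: every point has rank one.
  rank⁅e⁆≡1 : ∀ e → r ⁅ e ⁆ ≡ 1
  rank⁅e⁆≡1 e = ℕ.≤-antisym (subst (r ⁅ e ⁆ ≤_) (∣⁅x⁆∣≡1 e) (rank-≤-size ⁅ e ⁆))
                             (ℕ.≮⇒≥ λ r<1 → proj₁ simple e (dependent r<1 , minimal))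
    where
    dependent : r ⁅ e ⁆ < 1 → Dependent r ⁅ e ⁆
    dependent = subst (r ⁅ e ⁆ <_) (sym (∣⁅x⁆∣≡1 e))
    minimal : ∀ D → D ⊂ ⁅ e ⁆ → ¬ Dependent r D
    minimal D D⊂⁅e⁆ dep = ℕ.n≮0 (subst (r D <_) (ℕ.n<1⇒n≡0 (subst (∣ D ∣ <_) (∣⁅x⁆∣≡1 e) (p⊂q⇒∣p∣<∣q∣ D⊂⁅e⁆))) dep)

  size≤1⇒independent : ∀ D → ∣ D ∣ ≤ 1 → ¬ Dependent r D
  size≤1⇒independent D D≤1 dep with ∣p∣≡1⇒singleton D (ℕ.≤-antisym D≤1 (ℕ.≤-<-trans z≤n dep))
  ... | e , refl = ℕ.<-irrefl refl (subst₂ _<_ (rank⁅e⁆≡1 e) (∣⁅x⁆∣≡1 e) dep)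

  -- No parallel elements: two distinct points span rank two.
  2≤rank-pair : ∀ e f → e ≢ f → 2 ≤ r (⁅ e ⁆ ∪ ⁅ f ⁆)
  2≤rank-pair e f e≢f = ℕ.≮⇒≥ λ r<2 → proj₂ simple e f (e≢f , dependent r<2 , minimal)
    where
    dependent : r (⁅ e ⁆ ∪ ⁅ f ⁆) < 2 → Dependent r (⁅ e ⁆ ∪ ⁅ f ⁆)
    dependent = subst (r (⁅ e ⁆ ∪ ⁅ f ⁆) <_) (sym (∣pair∣≡2 e f e≢f))
    minimal : ∀ D → D ⊂ ⁅ e ⁆ ∪ ⁅ f ⁆ → ¬ Dependent r D
    minimal D D⊂pair = size≤1⇒independent D
      (ℕ.≤-pred (subst (∣ D ∣ <_) (∣pair∣≡2 e f e≢f) (p⊂q⇒∣p∣<∣q∣ D⊂pair)))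

  rank≤1⇒⊆⁅e⁆ : ∀ z e → r z ≤ 1 → e ∈ z → z ⊆ ⁅ e ⁆
  rank≤1⇒⊆⁅e⁆ z e rz≤1 e∈z {f} f∈z with f Fin.≟ e
  ... | yes refl = x∈⁅x⁆ f
  ... | no f≢e = contradiction (ℕ.≤-trans (2≤rank-pair e f (f≢e ∘ sym)) (rank-mono _ z (pair⊆ e∈z f∈z)))
                               (ℕ.<⇒≱ (s≤s rz≤1))

  -- Points are flats: adding a second point raises the rank from one to two.
  ⁅e⁆-flat : ∀ e → Flat ⁅ e ⁆
  ⁅e⁆-flat e f f∉⁅e⁆ = subst (_< r (⁅ e ⁆ ∪ ⁅ f ⁆)) (sym (rank⁅e⁆≡1 e))
    (2≤rank-pair e f λ e≡f → f∉⁅e⁆ (subst (_∈ ⁅ e ⁆) e≡f (x∈⁅x⁆ e)))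

  atom⇒point : ∀ z → Flat z × r z ≡ 1 → ∣ z ∣ ≡ 1
  atom⇒point z (_ , rz≡1) = at-most-one (0<∣p∣⇒nonempty z 1≤∣z∣)
    where
    1≤∣z∣ : 1 ≤ ∣ z ∣
    1≤∣z∣ = subst (_≤ ∣ z ∣) rz≡1 (rank-≤-size z)
    at-most-one : Nonempty z → ∣ z ∣ ≡ 1
    at-most-one (e , e∈z) = ℕ.≤-antisym
      (subst (∣ z ∣ ≤_) (∣⁅x⁆∣≡1 e) (p⊆q⇒∣p∣≤∣q∣ (rank≤1⇒⊆⁅e⁆ z e (ℕ.≤-reflexive rz≡1) e∈z)))
      1≤∣z∣

  point⇒atom : ∀ z → ∣ z ∣ ≡ 1 → Flat z × r z ≡ 1
  point⇒atom z ∣z∣≡1 with ∣p∣≡1⇒singleton z ∣z∣≡1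
  ... | e , refl = ⁅e⁆-flat e , rank⁅e⁆≡1 e

  a≡size : ∀ x → a x ≡ ∣ x ∣
  a≡size x = begin
    length (filter (_⊆? x) (filter (λ z → r z ℕ.≟ 1) (filter flat? S)))
      ≡⟨ cong length (filter-filter (_⊆? x) (λ z → r z ℕ.≟ 1) (filter flat? S)) ⟩
    length (filter (λ z → (r z ℕ.≟ 1) ×-dec (z ⊆? x)) (filter flat? S))
      ≡⟨ cong length (filter-filter (λ z → (r z ℕ.≟ 1) ×-dec (z ⊆? x)) flat? S) ⟩
    length (filter (λ z → flat? z ×-dec ((r z ℕ.≟ 1) ×-dec (z ⊆? x))) S)
      ≡⟨ cong length (filter-ext (λ z → flat? z ×-dec ((r z ℕ.≟ 1) ×-dec (z ⊆? x))) (pointOf? x)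
           (λ { z (flat , rz≡1 , z⊆x) → atom⇒point z (flat , rz≡1) , z⊆x })
           (λ { z (∣z∣≡1 , z⊆x) → proj₁ (point⇒atom z ∣z∣≡1) , proj₂ (point⇒atom z ∣z∣≡1) , z⊆x }) S) ⟩
    length (filter (pointOf? x) S)
      ≡⟨ count-points x ⟩
    ∣ x ∣ ∎
    where
    open ≡-Reasoning
    S = allSubsets n

module Coefficients {n : ℕ} (r : Subset n → ℕ) where
  open Lattice r

  Σμ : List (Subset n × Subset n) → ℤ
  Σμ ps = sumℤ (map (λ p → μ (proj₁ p) (proj₂ p)) ps)

  level? : (g : Subset n → ℕ) (i j : ℕ)
    → Decidable (λ (p : Subset n × Subset n) → (g (proj₁ p) ≡ i) × (rL ∸ r (proj₂ p) ≡ j))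
  level? g i j p = (g (proj₁ p) ℕ.≟ i) ×-dec ((rL ∸ r (proj₂ p)) ℕ.≟ j)

  coeff-agree : ∀ g h i → (∀ x → g x ≡ i → h x ≡ i) → (∀ x → h x ≡ i → g x ≡ i)
    → ∀ j → coeffWith g i j ≡ coeffWith h i j
  coeff-agree g h i g⇒h h⇒g j = cong Σμ (filter-ext (level? g i j) (level? h i j)
    (λ { (x , y) (gx≡i , deg) → g⇒h x gx≡i , deg }) (λ { (x , y) (hx≡i , deg) → h⇒g x hx≡i , deg }) pairs)

  pairs-flat : All (λ p → Flat (proj₁ p)) pairs
  pairs-flat = concat⁺ (map⁺ (All.map (λ flat → map⁺ (All.universal (λ _ → flat) _))
                                       (all-filter flat? (allSubsets n))))

  coeff-vanish : ∀ g i → (∀ x → Flat x → g x ≢ i) → ∀ j → coeffWith g i j ≡ 0ℤ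
  coeff-vanish g i none j = cong Σμ (filter-none (level? g i j)
    (All.map (λ {p} flat (gx≡i , _) → none (proj₁ p) flat gx≡i) pairs-flat))

  μ-refl : ∀ x → μ x x ≡ 1ℤ
  μ-refl x with x ≟S x
  ... | yes _ = refl
  ... | no x≢x = contradiction refl x≢x

  ⊤-flat : Flat ⊤
  ⊤-flat e e∉⊤ = contradiction ∈⊤ e∉⊤

  flats-at-⊤ : filter (_≟S ⊤) flats ≡ ⊤ ∷ []
  flats-at-⊤ = trans (filter-filter (_≟S ⊤) flat? (allSubsets n))
    (trans (filter-ext (λ z → flat? z ×-dec (z ≟S ⊤)) (_≟S ⊤) (λ _ → proj₂) (λ { _ refl → ⊤-flat , refl })
             (allSubsets n))
           (allSubsets-once ⊤))

  pairs-at-⊤ : filter (λ p → proj₁ p ≟S ⊤) pairs ≡ (⊤ , ⊤) ∷ []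
  pairs-at-⊤ = begin
    filter (λ p → proj₁ p ≟S ⊤) pairs
      ≡⟨ filter-by-fst (_≟S ⊤) above flats ⟩
    concatMap (λ x → map (x ,_) (above x)) (filter (_≟S ⊤) flats)
      ≡⟨ cong (concatMap (λ x → map (x ,_) (above x))) flats-at-⊤ ⟩
    map (⊤ ,_) (above ⊤) ++ []
      ≡⟨ ++-identityʳ _ ⟩
    map (⊤ ,_) (above ⊤)
      ≡⟨ cong (map (⊤ ,_)) (trans (filter-ext (⊤ ⊆?_) (_≟S ⊤) (λ y ⊤⊆y → ⊆-antisym ⊆⊤ ⊤⊆y)
                                                 (λ { _ refl → λ x∈⊤ → x∈⊤ }) flats)
                                     flats-at-⊤) ⟩
    (⊤ , ⊤) ∷ [] ∎
    where
    open ≡-Reasoning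
    above : Subset n → List (Subset n)
    above x = filter (x ⊆?_) flats

  -- Concentration at the top: if the level set {x : g x = i} is {⊤}, the
  -- coefficient is μ(⊤,⊤) T⁰ = 1.
  coeff-top : ∀ g i → (∀ x → g x ≡ i → x ≡ ⊤) → g ⊤ ≡ i → ∀ j → coeffWith g i j ≡ onePoly j
  coeff-top g i level⇒⊤ g⊤≡i j = begin
    Σμ (filter (level? g i j) pairs)
      ≡⟨ cong Σμ (filter-ext (level? g i j) (λ p → at⊤? p ×-dec degree? p)
           (λ { (x , y) (gx≡i , deg) → level⇒⊤ x gx≡i , deg })
           (λ { (x , y) (refl , deg) → g⊤≡i , deg }) pairs) ⟩
    Σμ (filter (λ p → at⊤? p ×-dec degree? p) pairs)
      ≡⟨ cong Σμ (sym (filter-filter degree? at⊤? pairs)) ⟩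
    Σμ (filter degree? (filter at⊤? pairs))
      ≡⟨ cong (Σμ ∘ filter degree?) pairs-at-⊤ ⟩
    Σμ (filter degree? ((⊤ , ⊤) ∷ []))
      ≡⟨ top-term j ⟩
    onePoly j ∎
    where
    open ≡-Reasoning
    at⊤? : Decidable (λ (p : Subset n × Subset n) → proj₁ p ≡ ⊤)
    at⊤? p = proj₁ p ≟S ⊤
    degree? : Decidable (λ (p : Subset n × Subset n) → rL ∸ r (proj₂ p) ≡ j)
    degree? p = (rL ∸ r (proj₂ p)) ℕ.≟ j
    -- the single pair (⊤, ⊤) has T-degree r(L) − r(⊤) = 0
    top-term : ∀ k → Σμ (filter (λ p → (rL ∸ r (proj₂ p)) ℕ.≟ k) ((⊤ , ⊤) ∷ [])) ≡ onePoly k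
    top-term 0 = trans (cong Σμ (filter-accept (λ p → (rL ∸ r (proj₂ p)) ℕ.≟ 0) (ℕ.n∸n≡0 rL)))
                       (trans (ℤ.+-identityʳ _) (μ-refl ⊤))
    top-term (suc k) = cong Σμ (filter-reject (λ p → (rL ∸ r (proj₂ p)) ℕ.≟ suc k)
                                  λ deg → ℕ.0≢1+n (trans (sym (ℕ.n∸n≡0 rL)) deg))

mainTheorem4 : (n : ℕ) (r : Subset n → ℕ) → IsMatroid r
    → Simple r → Simple (dualRank r)
    → (d d* : ℕ) → IsMinCocircuitSize r d → IsMinCircuitSize r d*
    → ((i : ℕ) → i + 1 < d* → (j : ℕ) → Lattice.χ r i j ≡ Lattice.μPoly r i j)
      × ((i : ℕ) → n < i + d → i < n → (j : ℕ) → Lattice.χ r i j ≡ 0ℤ)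
      × ((j : ℕ) → Lattice.χ r n j ≡ onePoly j)
mainTheorem4 n r isM simple _ d d* cogirth girth = below-girth , vanishing , top
  where
  open Lattice r using (a)
  open Coefficients r
  open Matroid r isM
  open SimpleMatroid r isM simple

  a≡i⇒size≡i : ∀ {i} x → a x ≡ i → ∣ x ∣ ≡ i
  a≡i⇒size≡i x ax≡i = trans (sym (a≡size x)) ax≡i

  -- (1) below the girth, a(x) = ∣x∣ = i exactly when r(x) = i
  below-girth : ∀ i → i + 1 < d* → ∀ j → Lattice.χ r i j ≡ Lattice.μPoly r i j
  below-girth i i+1<d* = coeff-agree a r i
    (λ x ax≡i → size≡i⇒rank≡i x (a≡i⇒size≡i x ax≡i))
    (λ x rx≡i → trans (a≡size x) (rank≡i⇒size≡i x rx≡i))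
    where open BelowGirth girth i i+1<d*

  -- (2) a proper flat x has ∣x∣ + d ≤ n, so none has n − d < a(x) < n
  vanishing : ∀ i → n < i + d → i < n → ∀ j → Lattice.χ r i j ≡ 0ℤ
  vanishing i n<i+d i<n = coeff-vanish a i λ { x flat ax≡i → ℕ.<⇒≱ n<i+d
    (subst (λ k → k + d ≤ n) (a≡i⇒size≡i x ax≡i)
      (proper-flat-size cogirth x flat (subst (_< n) (sym (a≡i⇒size≡i x ax≡i)) i<n))) }

  -- (3) a(x) = n only for x = ⊤
  top : ∀ j → Lattice.χ r n j ≡ onePoly j
  top = coeff-top a n (λ x ax≡n → ∣p∣≡n⇒p≡⊤ (a≡i⇒size≡i x ax≡n)) (trans (a≡size ⊤) (∣⊤∣≡n n))
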